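{- For all integers $e,n\ge 1$ and every positive divisor $d$ of $e$, there exists a cyclic $P_{e+1}$-decomposition of the complete multipartite graph $K_{(\frac{e}{d}+1)\times 2dn}$, where $P_{e+1}$ is the path on $e+1$ vertices.
   Context: $K_{a\times b}$ denotes the complete $a$-partite graph with $a$ parts each of size $b$. For a graph $\Gamma$, a $\Gamma$-decomposition of a graph $K$ is a set of subgraphs of $K$ each isomorphic to $\Gamma$ whose edge sets partition $E(K)$; it is cyclic if some bijection of $V(K)$ that is a single cycle of length $|V(K)|$ maps the set of blocks onto itself. -}

module Defs where

open import Data.Nat using (ℕ; zero; suc)
open import Data.Fin using (Fin; inject₁) renaming (suc to fsuc)
open import Data.Product using (Σ; ∃; _×_; _,_; proj₁)
open import Data.Sum using (_⊎_)
open import Relation.Binary.PropositionalEquality using (_≡_; _≢_)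
open import Relation.Nullary using (¬_)
open import Function.Bundles using (_↔_; Inverse)
open import Function.Definitions using (Injective)

-- Vertices of K_{a×b}: a pair (part, index within part).
Vtx : ℕ → ℕ → Set
Vtx a b = Fin a × Fin b

Adj : ∀ {a b} → Vtx a b → Vtx a b → Set
Adj u v = proj₁ u ≢ proj₁ v

Seq : ℕ → ℕ → ℕ → Set
Seq m a b = Fin (suc m) → Vtx a b

-- p is (the vertex sequence of) a subgraph of K_{a×b} isomorphic to the
-- path P_{m+1}: m+1 distinct vertices, consecutive ones adjacent.
IsPathIn : ∀ {m a b} → Seq m a b → Set
IsPathIn {m} p = Injective _≡_ _≡_ p × ((i : Fin m) → Adj (p (inject₁ i)) (p (fsuc i)))

EdgeAt : ∀ {m a b} → Seq m a b → Fin m → Vtx a b → Vtx a b → Set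
EdgeAt p i x y = (p (inject₁ i) ≡ x × p (fsuc i) ≡ y) ⊎ (p (inject₁ i) ≡ y × p (fsuc i) ≡ x)

HasEdge : ∀ {m a b} → Seq m a b → Vtx a b → Vtx a b → Set
HasEdge {m} p x y = Σ (Fin m) λ i → EdgeAt p i x y

HasVertex : ∀ {m a b} → Seq m a b → Vtx a b → Set
HasVertex {m} p v = Σ (Fin (suc m)) λ i → p i ≡ v

_⇔'_ : Set → Set → Set
A ⇔' B = (A → B) × (B → A)

SameSubgraph : ∀ {m a b} → Seq m a b → Seq m a b → Set
SameSubgraph p q = (∀ v → HasVertex p v ⇔' HasVertex q v)
                 × (∀ x y → HasEdge p x y ⇔' HasEdge q x y)

-- A family of t blocks, each a copy of P_{m+1} in K_{a×b}, whose edge sets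
-- partition E(K_{a×b}): every edge lies in exactly one block (at exactly
-- one position, which is automatic for a path).
IsPathDecomposition : ∀ {m a b t} → (Fin t → Seq m a b) → Set
IsPathDecomposition {m} {a} {b} {t} B =
    ((k : Fin t) → IsPathIn (B k))
  × (∀ (x y : Vtx a b) → Adj x y →
       Σ (Fin t × Fin m) (λ { (k , i) → EdgeAt (B k) i x y })
     × (∀ k i k' i' → EdgeAt (B k) i x y → EdgeAt (B k') i' x y →
          (k ≡ k') × (i ≡ i')))

iter : ∀ {A : Set} → (A → A) → ℕ → A → A
iter f zero x = x
iter f (suc n) x = f (iter f n x)

-- A permutation σ of V is a single cycle of length |V|:
-- every vertex is reached from every vertex by iterating σ.
IsFullCycle : ∀ {V : Set} → (V ↔ V) → Set
IsFullCycle {V} σ = ∀ (u w : V) → ∃ λ k → iter (Inverse.to σ) k u ≡ w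

MapsBlocksOnto : ∀ {m a b t} → (Vtx a b ↔ Vtx a b) → (Fin t → Seq m a b) → Set
MapsBlocksOnto {t = t} σ B =
    ((k : Fin t) → Σ (Fin t) λ k' → SameSubgraph (λ i → Inverse.to σ (B k i)) (B k'))
  × ((k' : Fin t) → Σ (Fin t) λ k → SameSubgraph (λ i → Inverse.to σ (B k i)) (B k'))

HasCyclicPathDecomposition : ℕ → ℕ → ℕ → Set
HasCyclicPathDecomposition m a b =
  Σ ℕ λ t → Σ (Fin t → Seq m a b) λ B →
    IsPathDecomposition B
  × Σ (Vtx a b ↔ Vtx a b) λ σ → IsFullCycle σ × MapsBlocksOnto σ B

-- Put m = e/d, a = m+1, b = 2dn, K = dn; there are N = ab vertices and half a
-- turn is H = N/2 = Ka. Labelling the vertices by the residues mod N so that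
-- the part of a vertex is its label mod a (module Circulant), the rotation
-- u ↦ u+1 is a single N-cycle and two vertices are adjacent iff their
-- difference is not divisible by a. Each edge has a difference d < H (in one of
-- its two directions), and the admissible d < H with a ∤ d are exactly
-- K·m = n·e numbers, listed decreasingly by Δ (module Differences). Cutting
-- this list into n runs of e values and drawing each run as a zigzag
-- 0, δ0, δ0−δ1, δ0−δ1+δ2, … gives n base paths (module ZigzagFamily): a
-- zigzag with decreasing jumps never revisits a point (zigzag-injective).
-- The difference method (Circulant.DifferenceMethod) then shows that the N
-- rotations of the n base paths form a cyclic decomposition.
module Submission where

open import Defs
open import Data.Nat
  using (ℕ; zero; suc; z<s; z≤n; s≤s; pred; _+_; _*_; _∸_; _<_; _≤_; _≥_; NonZero; >-nonZero; >-nonZero⁻¹; ≢-nonZero)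
open import Data.Nat.Properties
open import Data.Nat.DivMod
open import Data.Nat.Divisibility using (_∣_; n∣m*n; m∣m*n; ∣-refl)
open import Data.Fin using (Fin; toℕ; fromℕ<; combine; remQuot; inject₁) renaming (suc to fsuc)
open import Data.Fin.Properties
  using (toℕ-injective; toℕ<n; toℕ-fromℕ<; toℕ-inject₁; toℕ-combine; remQuot-combine; combine-remQuot;
         combine-injectiveˡ; combine-injectiveʳ)
open import Function.Bundles using (_↔_; mk↔ₛ′)
open import Data.Nat.Tactic.RingSolver using (solve-∀)
open import Data.Product using (Σ; _×_; _,_; proj₁; proj₂; swap; uncurry; map₂)
open import Data.Sum using (_⊎_; inj₁; inj₂)
open import Function using (_∘_)
open import Relation.Binary.PropositionalEquality
open import Relation.Nullary using (contradiction; yes; no)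
open import Data.Empty using (⊥; ⊥-elim)

module Modulo (M : ℕ) .{{_ : NonZero M}} where

  %-absorbˡ : ∀ x y → (x % M + y) % M ≡ (x + y) % M
  %-absorbˡ x y = begin
    (x % M + y) % M             ≡⟨ %-distribˡ-+ (x % M) y M ⟩
    (x % M % M + y % M) % M     ≡⟨ cong (λ z → (z + y % M) % M) (m%n%n≡m%n x M) ⟩
    (x % M + y % M) % M         ≡⟨ %-distribˡ-+ x y M ⟨
    (x + y) % M                 ∎
    where open ≡-Reasoning

  %-absorbʳ : ∀ x y → (x + y % M) % M ≡ (x + y) % M
  %-absorbʳ x y = begin
    (x + y % M) % M  ≡⟨ cong (_% M) (+-comm x (y % M)) ⟩
    (y % M + x) % M  ≡⟨ %-absorbˡ y x ⟩
    (y + x) % M      ≡⟨ cong (_% M) (+-comm y x) ⟩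
    (x + y) % M      ∎
    where open ≡-Reasoning

  -- Translation by c is undone by translation by c·(M-1), since c·M ≡ 0.
  %-cancelˡ : ∀ c x y → (c + x) % M ≡ (c + y) % M → x % M ≡ y % M
  %-cancelˡ c x y eq = trans (undo x) (trans (cong (λ z → (k + z) % M) eq) (sym (undo y)))
    where
      k = c * pred M
      rearrange : ∀ z c p → z + c * suc p ≡ c * p + (c + z)
      rearrange = solve-∀
      undo : ∀ z → z % M ≡ (k + (c + z) % M) % M
      undo z = begin
        z % M                 ≡⟨ [m+kn]%n≡m%n z c M ⟨
        (z + c * M) % M       ≡⟨ cong (λ w → (z + c * w) % M) (suc-pred M) ⟨
        (z + c * suc (pred M)) % M ≡⟨ cong (_% M) (rearrange z c (pred M)) ⟩
        (k + (c + z)) % M     ≡⟨ %-absorbʳ k (c + z) ⟨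
        (k + (c + z) % M) % M ∎
        where open ≡-Reasoning

  %-cancelʳ : ∀ c x y → (x + c) % M ≡ (y + c) % M → x % M ≡ y % M
  %-cancelʳ c x y eq = %-cancelˡ c x y (trans (cong (_% M) (+-comm c x)) (trans eq (cong (_% M) (+-comm y c))))

  %-injective : ∀ {x y} → x < M → y < M → x % M ≡ y % M → x ≡ y
  %-injective {x} {y} x<M y<M eq = trans (sym (m<n⇒m%n≡m x<M)) (trans eq (m<n⇒m%n≡m y<M))

  [r+qM]%M≡r : ∀ r q → r < M → (r + q * M) % M ≡ r
  [r+qM]%M≡r r q r<M = trans ([m+kn]%n≡m%n r q M) (m<n⇒m%n≡m r<M)

  [r+qM]/M≡q : ∀ r q → r < M → (r + q * M) / M ≡ q
  [r+qM]/M≡q r q r<M = begin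
    (r + q * M) / M    ≡⟨ +-distrib-/-∣ʳ r (n∣m*n q) ⟩
    r / M + q * M / M  ≡⟨ cong₂ _+_ (m<n⇒m/n≡0 r<M) (m*n/n≡m q M) ⟩
    q                  ∎
    where open ≡-Reasoning

Jump : ℕ → ℕ → ℕ → Set
Jump p x q = q ≡ p + x ⊎ p ≡ q + x

∸-reflect : ∀ D p x → p + x ≤ D → D ∸ p ≡ D ∸ (p + x) + x
∸-reflect D p x le = begin
  D ∸ p                  ≡⟨ cong (_∸ p) (m∸n+n≡m le) ⟨
  (y + (p + x)) ∸ p      ≡⟨ cong (_∸ p) (regroup y p x) ⟩
  (y + x + p) ∸ p        ≡⟨ m+n∸n≡m (y + x) p ⟩
  y + x                  ∎
  where
    open ≡-Reasoning
    y = D ∸ (p + x)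
    regroup : ∀ y p x → y + (p + x) ≡ y + x + p
    regroup = solve-∀

jump-reflect : ∀ {p x q} D → p ≤ D → q ≤ D → Jump p x q → Jump (D ∸ p) x (D ∸ q)
jump-reflect {p} {x} D _   q≤D (inj₁ refl) = inj₂ (∸-reflect D p x q≤D)
jump-reflect {x = x} {q} D p≤D _ (inj₂ refl) = inj₁ (∸-reflect D q x p≤D)

Descending : (ℕ → ℕ) → ℕ → Set
Descending δ e = ∀ i → i < e → δ (suc i) < δ i

descending-tail : ∀ {δ e} → Descending δ (suc e) → Descending (δ ∘ suc) e
descending-tail desc i i<e = desc (suc i) (s≤s i<e)

-- The zigzag with jumps δ 0, δ 1, …: 0, δ0, δ0−δ1, δ0−δ1+δ2, …, defined as
-- the zigzag of the tail (δ 1, δ 2, …) reflected in δ 0.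
zigzag : (ℕ → ℕ) → ℕ → ℕ
zigzag δ zero    = 0
zigzag δ (suc i) = δ 0 ∸ zigzag (δ ∘ suc) i

zigzag≤ : ∀ δ i → zigzag δ i ≤ δ 0
zigzag≤ δ zero    = z≤n
zigzag≤ δ (suc i) = m∸n≤m (δ 0) (zigzag (δ ∘ suc) i)

zigzag-tail< : ∀ {δ e} → Descending δ e → 0 < e → ∀ i → zigzag (δ ∘ suc) i < δ 0
zigzag-tail< {δ} desc 0<e i = ≤-<-trans (zigzag≤ (δ ∘ suc) i) (desc 0 0<e)

zigzag-jump : ∀ {δ e} → Descending δ e → ∀ {i} → i < e → Jump (zigzag δ i) (δ i) (zigzag δ (suc i))
zigzag-jump desc {zero} _ = inj₁ refl
zigzag-jump {δ} {suc e} desc {suc i} (s≤s i<e) =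
  jump-reflect (δ 0) (<⇒≤ (zigzag-tail< desc z<s i)) (<⇒≤ (zigzag-tail< desc z<s (suc i)))
               (zigzag-jump (descending-tail desc) i<e)

zigzag-injective : ∀ {δ e} → Descending δ e → ∀ {i j} → i ≤ e → j ≤ e →
                   zigzag δ i ≡ zigzag δ j → i ≡ j
zigzag-injective desc {zero}  {zero}  _ _ _ = refl
zigzag-injective desc {zero}  {suc j} _ (s≤s _) eq =
  contradiction eq (<⇒≢ (m<n⇒0<n∸m (zigzag-tail< desc z<s j)))
zigzag-injective desc {suc i} {zero}  (s≤s _) _ eq =
  contradiction (sym eq) (<⇒≢ (m<n⇒0<n∸m (zigzag-tail< desc z<s i)))
zigzag-injective {e = suc e} desc {suc i} {suc j} (s≤s i≤e) (s≤s j≤e) eq =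
  cong suc (zigzag-injective (descending-tail desc) i≤e j≤e
             (∸-cancelˡ-≡ (<⇒≤ (zigzag-tail< desc z<s i)) (<⇒≤ (zigzag-tail< desc z<s j)) eq))

nonZero-+1 : ∀ m → NonZero (m + 1)
nonZero-+1 m = subst NonZero (+-comm 1 m) _

-- The differences of K_{(m+1)×2K} that are shorter than half a turn
-- H = K(m+1) and do not join two vertices of the same part are
-- D < H with (m+1) ∤ D; there are exactly K·m of them. They are listed in
-- decreasing order as Δ G = H − 1 − φ G, where φ enumerates the numbers
-- below H whose residue modulo m+1 is not m, with inverse ψ.
module Differences (m K : ℕ) .{{_ : NonZero m}} where

  a H : ℕ
  a = m + 1
  H = K * a

  instance
    a≢0 : NonZero a
    a≢0 = nonZero-+1 m

  private
    module Modᵐ = Modulo m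
    module Modᵃ = Modulo a

  m<a : m < a
  m<a = m<m+n m z<s

  φ ψ : ℕ → ℕ
  φ G = G + G / m
  ψ X = X % a + (X / a) * m

  φ-split : ∀ G → φ G ≡ G % m + (G / m) * a
  φ-split G = begin
    G + G / m                        ≡⟨ cong (_+ G / m) (m≡m%n+[m/n]*n G m) ⟩
    G % m + (G / m) * m + G / m      ≡⟨ regroup (G % m) (G / m) m ⟩
    G % m + (G / m) * a              ∎
    where
      open ≡-Reasoning
      regroup : ∀ r q m → r + q * m + q ≡ r + q * (m + 1)
      regroup = solve-∀

  φ-residue : ∀ G → φ G % a ≡ G % m
  φ-residue G = trans (cong (_% a) (φ-split G)) (Modᵃ.[r+qM]%M≡r (G % m) (G / m) (<-trans (m%n<n G m) m<a))

  ψ∘φ : ∀ G → ψ (φ G) ≡ G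
  ψ∘φ G = begin
    φ G % a + (φ G / a) * m     ≡⟨ cong₂ (λ r q → r + q * m) (φ-residue G) quotient ⟩
    G % m + (G / m) * m         ≡⟨ m≡m%n+[m/n]*n G m ⟨
    G                           ∎
    where
      open ≡-Reasoning
      quotient : φ G / a ≡ G / m
      quotient = trans (cong (_/ a) (φ-split G)) (Modᵃ.[r+qM]/M≡q (G % m) (G / m) (<-trans (m%n<n G m) m<a))

  φ∘ψ : ∀ X → X % a < m → φ (ψ X) ≡ X
  φ∘ψ X low = begin
    φ (ψ X)                          ≡⟨ φ-split (ψ X) ⟩
    ψ X % m + (ψ X / m) * a          ≡⟨ cong₂ (λ r q → r + q * a) (Modᵐ.[r+qM]%M≡r (X % a) (X / a) low)
                                          (Modᵐ.[r+qM]/M≡q (X % a) (X / a) low) ⟩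
    X % a + (X / a) * a              ≡⟨ m≡m%n+[m/n]*n X a ⟨
    X                                ∎
    where open ≡-Reasoning

  φ-mono : ∀ {G G'} → G < G' → φ G < φ G'
  φ-mono G<G' = +-mono-<-≤ G<G' (/-monoˡ-≤ m (<⇒≤ G<G'))

  H≡Km+K : H ≡ K * m + K
  H≡Km+K = trans (*-distribˡ-+ K m 1) (cong (K * m +_) (*-identityʳ K))

  φ-bound : ∀ {G} → G < K * m → suc (φ G) < H
  φ-bound {G} G<Km = subst₂ _≤_ (cong suc (+-suc G (G / m))) (sym H≡Km+K)
                       (+-mono-≤ G<Km (m<n*o⇒m/o<n G<Km))

  ψ-bound : ∀ {X} → X < H → X % a < m → ψ X < K * m
  ψ-bound {X} X<H low = begin-strict
    X % a + (X / a) * m   <⟨ +-monoˡ-< ((X / a) * m) low ⟩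
    m + (X / a) * m       ≤⟨ *-monoˡ-≤ m (m<n*o⇒m/o<n {X} {K} {a} X<H) ⟩
    K * m                 ∎
    where open ≤-Reasoning

  H%a≡0 : H % a ≡ 0
  H%a≡0 = m*n%n≡0 K a

  complement-residue : ∀ {X Y} → X % a < m → Y + suc X ≡ H → Y % a ≢ 0
  complement-residue {X} {Y} low sum Y%a≡0 = 0≢1+n (begin
    0                     ≡⟨ H%a≡0 ⟨
    H % a                 ≡⟨ cong (_% a) sum ⟨
    (Y + suc X) % a       ≡⟨ Modᵃ.%-absorbˡ Y (suc X) ⟨
    (Y % a + suc X) % a   ≡⟨ cong (λ r → (r + suc X) % a) Y%a≡0 ⟩
    (1 + X) % a           ≡⟨ Modᵃ.%-absorbʳ 1 X ⟨
    suc (X % a) % a       ≡⟨ m<n⇒m%n≡m (≤-<-trans low m<a) ⟩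
    suc (X % a)           ∎)
    where open ≡-Reasoning

  complement-residue⁻ : ∀ {X Y} → Y % a ≢ 0 → Y + suc X ≡ H → X % a < m
  complement-residue⁻ {X} {Y} Y%a≢0 sum =
    ≤∧≢⇒< (≤-pred (subst (X % a <_) (+-comm m 1) (m%n<n X a))) top
    where
      open ≡-Reasoning
      top : X % a ≢ m
      top X%a≡m = Y%a≢0 (begin
        Y % a                  ≡⟨ [m+n]%n≡m%n Y a ⟨
        (Y + a) % a            ≡⟨ cong (λ r → (Y + r) % a) (+-comm m 1) ⟩
        (Y + suc m) % a        ≡⟨ cong (λ r → (Y + suc r) % a) X%a≡m ⟨
        (Y + suc (X % a)) % a  ≡⟨ cong (_% a) (+-suc Y (X % a)) ⟩
        (suc Y + X % a) % a    ≡⟨ Modᵃ.%-absorbʳ (suc Y) X ⟩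
        (suc Y + X) % a        ≡⟨ cong (_% a) (+-suc Y X) ⟨
        (Y + suc X) % a        ≡⟨ cong (_% a) sum ⟩
        H % a                  ≡⟨ H%a≡0 ⟩
        0                      ∎)

  Δ : ℕ → ℕ
  Δ G = H ∸ suc (φ G)

  Δ-complement : ∀ {G} → G < K * m → Δ G + suc (φ G) ≡ H
  Δ-complement G<Km = m∸n+n≡m (<⇒≤ (φ-bound G<Km))

  Δ<H : ∀ {G} → G < K * m → Δ G < H
  Δ<H G<Km = ∸-monoʳ-< z<s (<⇒≤ (φ-bound G<Km))

  Δ-descending : ∀ {G} → G < K * m → Δ (suc G) < Δ G
  Δ-descending {G} G<Km = ≤-<-trans (∸-monoʳ-≤ H (s≤s (φ-mono (n<1+n G))))
                                      (∸-monoʳ-< (n<1+n (suc (φ G))) (φ-bound G<Km))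

  Δ-admissible : ∀ {G} → G < K * m → Δ G % a ≢ 0
  Δ-admissible {G} G<Km = complement-residue (subst (_< m) (sym (φ-residue G)) (m%n<n G m)) (Δ-complement G<Km)

  Δ-injective : ∀ {G G'} → G < K * m → G' < K * m → Δ G ≡ Δ G' → G ≡ G'
  Δ-injective {G} {G'} G<Km G'<Km eq = begin
    G          ≡⟨ ψ∘φ G ⟨
    ψ (φ G)    ≡⟨ cong ψ (suc-injective (∸-cancelˡ-≡ (<⇒≤ (φ-bound G<Km)) (<⇒≤ (φ-bound G'<Km)) eq)) ⟩
    ψ (φ G')   ≡⟨ ψ∘φ G' ⟩
    G'         ∎
    where open ≡-Reasoning

  Δ-surjective : ∀ {D} → D < H → D % a ≢ 0 → Σ ℕ λ G → G < K * m × Δ G ≡ D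
  Δ-surjective {D} D<H D%a≢0 = ψ X , ψ-bound X<H low , (begin
      H ∸ suc (φ (ψ X))   ≡⟨ cong (λ Y → H ∸ suc Y) (φ∘ψ X low) ⟩
      H ∸ suc X           ≡⟨ cong (_∸ suc X) sum ⟨
      D + suc X ∸ suc X   ≡⟨ m+n∸n≡m D (suc X) ⟩
      D                   ∎)
    where
      open ≡-Reasoning
      X = H ∸ suc D
      X<H : X < H
      X<H = ∸-monoʳ-< z<s D<H
      sum : D + suc X ≡ H
      sum = trans (+-suc D X) (trans (cong suc (+-comm D X)) (trans (sym (+-suc X D)) (m∸n+n≡m D<H)))
      low : X % a < m
      low = complement-residue⁻ D%a≢0 sum

Joins : ∀ {A : Set} → A → A → A → A → Set
Joins P Q x y = (P ≡ x × Q ≡ y) ⊎ (P ≡ y × Q ≡ x)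

joins-flip : ∀ {A : Set} {P Q x y : A} → Joins P Q x y → Joins P Q y x
joins-flip (inj₁ ends) = inj₂ ends
joins-flip (inj₂ ends) = inj₁ ends

joins-sym : ∀ {A : Set} {P Q U W : A} → Joins P Q U W → Joins U W P Q
joins-sym (inj₁ (refl , refl)) = inj₁ (refl , refl)
joins-sym (inj₂ (refl , refl)) = inj₂ (refl , refl)

joins-transfer : ∀ {A : Set} {P Q U W x y : A} → Joins P Q U W → Joins P Q x y → Joins U W x y
joins-transfer (inj₁ (refl , refl)) j = j
joins-transfer (inj₂ (refl , refl)) j = joins-flip (swap-ends j)
  where
    swap-ends : ∀ {A : Set} {P Q x y : A} → Joins P Q x y → Joins Q P y x
    swap-ends (inj₁ (p , q)) = inj₁ (q , p)
    swap-ends (inj₂ (p , q)) = inj₂ (q , p)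

joins-map : ∀ {A B : Set} (f : A → B) {P Q x y : A} → Joins P Q x y → Joins (f P) (f Q) (f x) (f y)
joins-map f (inj₁ (refl , refl)) = inj₁ (refl , refl)
joins-map f (inj₂ (refl , refl)) = inj₂ (refl , refl)

joins-adjacent : ∀ {a b} {P Q U W : Vtx a b} → Joins P Q U W → Adj U W → Adj P Q
joins-adjacent (inj₁ (refl , refl)) adj = adj
joins-adjacent (inj₂ (refl , refl)) adj = λ eq → adj (sym eq)

lower : ∀ {p x q} → Jump p x q → ℕ
lower {p} (inj₁ _) = p
lower {q = q} (inj₂ _) = q

jump-joins : ∀ {p x q} (j : Jump p x q) → Joins p q (lower j) (lower j + x)
jump-joins (inj₁ refl) = inj₁ (refl , refl)
jump-joins (inj₂ refl) = inj₂ (refl , refl)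

same-subgraph : ∀ {m a b} {p q : Seq m a b} → (∀ i → p i ≡ q i) → SameSubgraph p q
same-subgraph {p = p} {q} p≗q = vertices , edges
  where
    vertices : ∀ v → HasVertex p v ⇔' HasVertex q v
    vertices v = (λ (i , eq) → i , trans (sym (p≗q i)) eq) , (λ (i , eq) → i , trans (p≗q i) eq)
    edges : ∀ x y → HasEdge p x y ⇔' HasEdge q x y
    edges x y = (λ (i , e) → i , joins-transfer (inj₁ (p≗q (inject₁ i) , p≗q (fsuc i))) e)
              , (λ (i , e) → i , joins-transfer (inj₁ (sym (p≗q (inject₁ i)) , sym (p≗q (fsuc i)))) e)

-- The circulant structure of K_{a×b}: its N = b·a vertices are labelled by
-- the residues modulo N so that the part of a vertex is its label mod a.
module Circulant (a b : ℕ) .{{_ : NonZero a}} .{{_ : NonZero b}} where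

  N : ℕ
  N = b * a

  instance
    N≢0 : NonZero N
    N≢0 = m*n≢0 b a

  private
    module Modᴺ = Modulo N
    module Modᵃ = Modulo a

  V : Set
  V = Vtx a b

  opaque
    -- The label in [0, N) of a vertex: a · (index in part) + part.
    idx : V → ℕ
    idx (i , j) = toℕ (combine j i)

    lab : ℕ → V
    lab u = swap (remQuot {b} a (fromℕ< (m%n<n u N)))

    idx<N : ∀ v → idx v < N
    idx<N (i , j) = toℕ<n (combine j i)

    idx-lab : ∀ u → idx (lab u) ≡ u % N
    idx-lab u = trans (idx-swap (remQuot {b} a k)) (trans (cong toℕ (combine-remQuot {b} a k)) (toℕ-fromℕ< _))
      where
        k : Fin (b * a)
        k = fromℕ< (m%n<n u N)
        idx-swap : ∀ p → idx (swap p) ≡ toℕ (uncurry combine p)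
        idx-swap (j , i) = refl

    lab-idx : ∀ v → lab (idx v) ≡ v
    lab-idx (i , j) = cong swap (trans (cong (remQuot {b} a) fromℕ<-combine) (remQuot-combine j i))
      where
        fromℕ<-combine : fromℕ< (m%n<n (toℕ (combine j i)) N) ≡ combine j i
        fromℕ<-combine = toℕ-injective (trans (toℕ-fromℕ< _) (m<n⇒m%n≡m (toℕ<n (combine j i))))

    lab-cong : ∀ {u v} → u % N ≡ v % N → lab u ≡ lab v
    lab-cong eq = cong (λ k → swap (remQuot {b} a k))
                       (toℕ-injective (trans (toℕ-fromℕ< _) (trans eq (sym (toℕ-fromℕ< _)))))

    part-lab : ∀ u → toℕ (proj₁ (lab u)) ≡ u % a
    part-lab u = begin
      toℕ (proj₁ (lab u))     ≡⟨ part (lab u) ⟩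
      idx (lab u) % a         ≡⟨ cong (_% a) (idx-lab u) ⟩
      u % N % a               ≡⟨ m∣n⇒o%n%m≡o%m a N u (n∣m*n b) ⟩
      u % a                   ∎
      where
        open ≡-Reasoning
        part : ∀ v → toℕ (proj₁ v) ≡ idx v % a
        part (i , j) = sym (begin
          toℕ (combine j i) % a        ≡⟨ cong (_% a) (toℕ-combine j i) ⟩
          (a * toℕ j + toℕ i) % a      ≡⟨ %-remove-+ˡ (toℕ i) (m∣m*n (toℕ j)) ⟩
          toℕ i % a                    ≡⟨ m<n⇒m%n≡m (toℕ<n i) ⟩
          toℕ i                        ∎)

  lab-injective : ∀ {u v} → lab u ≡ lab v → u % N ≡ v % N
  lab-injective {u} {v} eq = trans (sym (idx-lab u)) (trans (cong idx eq) (idx-lab v))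

  lab-translate : ∀ {u u'} d → lab u ≡ lab u' → lab (u + d) ≡ lab (u' + d)
  lab-translate {u} {u'} d eq = lab-cong (begin
    (u + d) % N        ≡⟨ Modᴺ.%-absorbˡ u d ⟨
    (u % N + d) % N    ≡⟨ cong (λ r → (r + d) % N) (lab-injective eq) ⟩
    (u' % N + d) % N   ≡⟨ Modᴺ.%-absorbˡ u' d ⟩
    (u' + d) % N       ∎)
    where open ≡-Reasoning

  same-part⇔ : ∀ u d → (proj₁ (lab u) ≡ proj₁ (lab (u + d))) ⇔' (d % a ≡ 0)
  same-part⇔ u d = to , from
    where
      to : proj₁ (lab u) ≡ proj₁ (lab (u + d)) → d % a ≡ 0
      to eq = sym (trans (sym (m<n⇒m%n≡m (>-nonZero⁻¹ a)))
                (Modᵃ.%-cancelˡ u 0 d (trans (cong (_% a) (+-identityʳ u))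
                  (trans (sym (part-lab u)) (trans (cong toℕ eq) (part-lab (u + d)))))))
      from : d % a ≡ 0 → proj₁ (lab u) ≡ proj₁ (lab (u + d))
      from d%a≡0 = toℕ-injective (begin
        toℕ (proj₁ (lab u))        ≡⟨ part-lab u ⟩
        u % a                      ≡⟨ cong (_% a) (+-identityʳ u) ⟨
        (u + 0) % a                ≡⟨ cong (λ r → (u + r) % a) d%a≡0 ⟨
        (u + d % a) % a            ≡⟨ Modᵃ.%-absorbʳ u d ⟩
        (u + d) % a                ≡⟨ part-lab (u + d) ⟨
        toℕ (proj₁ (lab (u + d)))  ∎)
        where open ≡-Reasoning

  shift : ℕ → V → V
  shift k v = lab (idx v + k)

  shift-lab : ∀ k u → shift k (lab u) ≡ lab (u + k)
  shift-lab k u = lab-translate k (lab-cong (trans (cong (_% N) (idx-lab u)) (m%n%n≡m%n u N)))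

  shift-inverse : ∀ {k k'} → k' + k ≡ N → ∀ v → shift k (shift k' v) ≡ v
  shift-inverse {k} {k'} sum v = begin
    shift k (lab (idx v + k'))   ≡⟨ shift-lab k (idx v + k') ⟩
    lab (idx v + k' + k)         ≡⟨ cong lab (trans (+-assoc (idx v) k' k) (cong (idx v +_) sum)) ⟩
    lab (idx v + N)              ≡⟨ lab-cong ([m+n]%n≡m%n (idx v) N) ⟩
    lab (idx v)                  ≡⟨ lab-idx v ⟩
    v                            ∎
    where open ≡-Reasoning

  rotation : V ↔ V
  rotation = mk↔ₛ′ (shift 1) (shift (pred N))
               (shift-inverse (trans (+-comm (pred N) 1) (suc-pred N)))
               (shift-inverse (suc-pred N))

  iterate-rotation : ∀ k u → iter (shift 1) k (lab u) ≡ lab (u + k)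
  iterate-rotation zero    u = cong lab (sym (+-identityʳ u))
  iterate-rotation (suc k) u = begin
    shift 1 (iter (shift 1) k (lab u))  ≡⟨ cong (shift 1) (iterate-rotation k u) ⟩
    shift 1 (lab (u + k))               ≡⟨ shift-lab 1 (u + k) ⟩
    lab (u + k + 1)                     ≡⟨ cong lab (trans (+-assoc u k 1) (cong (u +_) (+-comm k 1))) ⟩
    lab (u + suc k)                     ∎
    where open ≡-Reasoning

  rotation-cycle : IsFullCycle rotation
  rotation-cycle v w = k , (begin
    iter (shift 1) k v               ≡⟨ cong (iter (shift 1) k) (lab-idx v) ⟨
    iter (shift 1) k (lab (idx v))   ≡⟨ iterate-rotation k (idx v) ⟩
    lab (idx v + k)                  ≡⟨ cong lab (sym (+-assoc (idx v) (N ∸ idx v) (idx w))) ⟩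
    lab (idx v + (N ∸ idx v) + idx w) ≡⟨ cong (λ r → lab (r + idx w)) (m+[n∸m]≡n (<⇒≤ (idx<N v))) ⟩
    lab (N + idx w)                  ≡⟨ lab-cong (%-remove-+ˡ (idx w) (∣-refl {N})) ⟩
    lab (idx w)                      ≡⟨ lab-idx w ⟩
    w                                ∎)
    where
      open ≡-Reasoning
      k = (N ∸ idx v) + idx w

  diff : V → V → ℕ
  diff x y = (idx y + (N ∸ idx x)) % N

  diff<N : ∀ x y → diff x y < N
  diff<N x y = m%n<n (idx y + (N ∸ idx x)) N

  diff-spec : ∀ x y → lab (idx x + diff x y) ≡ y
  diff-spec x y = begin
    lab (idx x + diff x y)                 ≡⟨ lab-cong (Modᴺ.%-absorbʳ (idx x) (idx y + (N ∸ idx x))) ⟩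
    lab (idx x + (idx y + (N ∸ idx x)))    ≡⟨ cong lab (exchange (idx x) (idx y) (N ∸ idx x)) ⟩
    lab (idx y + (idx x + (N ∸ idx x)))    ≡⟨ cong (λ r → lab (idx y + r)) (m+[n∸m]≡n (<⇒≤ (idx<N x))) ⟩
    lab (idx y + N)                        ≡⟨ lab-cong ([m+n]%n≡m%n (idx y) N) ⟩
    lab (idx y)                            ≡⟨ lab-idx y ⟩
    y                                      ∎
    where
      open ≡-Reasoning
      exchange : ∀ x y k → x + (y + k) ≡ y + (x + k)
      exchange = solve-∀

  lab-step : ∀ {u x} y → lab u ≡ x → lab (u + diff x y) ≡ y
  lab-step {x = x} y eq = trans (lab-translate (diff x y) (trans eq (sym (lab-idx x)))) (diff-spec x y)

  diff-unique : ∀ {u d x y} → d < N → lab u ≡ x → lab (u + d) ≡ y → diff x y ≡ d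
  diff-unique {u} {d} {x} {y} d<N at-x at-y = Modᴺ.%-injective (diff<N x y) d<N
    (Modᴺ.%-cancelˡ u (diff x y) d (lab-injective (trans (lab-step y at-x) (sym at-y))))

  diff-flip : ∀ {x y} → x ≢ y → diff y x ≡ N ∸ diff x y
  diff-flip {x} {y} x≢y = diff-unique (∸-monoʳ-< d>0 (<⇒≤ (diff<N x y))) (diff-spec x y) (begin
    lab (idx x + d + (N ∸ d))   ≡⟨ cong lab (+-assoc (idx x) d (N ∸ d)) ⟩
    lab (idx x + (d + (N ∸ d))) ≡⟨ cong (λ r → lab (idx x + r)) (m+[n∸m]≡n (<⇒≤ (diff<N x y))) ⟩
    lab (idx x + N)             ≡⟨ lab-cong ([m+n]%n≡m%n (idx x) N) ⟩
    lab (idx x)                 ≡⟨ lab-idx x ⟩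
    x                           ∎)
    where
      open ≡-Reasoning
      d = diff x y
      d>0 : 0 < d
      d>0 = n≢0⇒n>0 (λ d≡0 → x≢y (begin
        x                ≡⟨ lab-idx x ⟨
        lab (idx x)      ≡⟨ cong lab (+-identityʳ (idx x)) ⟨
        lab (idx x + 0)  ≡⟨ cong (λ r → lab (idx x + r)) d≡0 ⟨
        lab (idx x + d)  ≡⟨ diff-spec x y ⟩
        y                ∎))

  adjacent-lab : ∀ u d → d % a ≢ 0 → Adj (lab u) (lab (u + d))
  adjacent-lab u d a∤d same = a∤d (proj₁ (same-part⇔ u d) same)

  adjacent-diff : ∀ {x y} → Adj x y → diff x y % a ≢ 0
  adjacent-diff {x} {y} adj a∣d =
    adj (subst₂ (λ p q → proj₁ p ≡ proj₁ q) (lab-idx x) (diff-spec x y)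
                (proj₂ (same-part⇔ (idx x) (diff x y)) a∣d))

  Chord : ℕ → ℕ → V → V → Set
  Chord u d x y = Joins (lab u) (lab (u + d)) x y

  module HalfTurn {H : ℕ} (N≡H+H : N ≡ H + H) where

    <H⇒<N : ∀ {d} → d < H → d < N
    <H⇒<N {d} d<H = subst (d <_) (sym N≡H+H) (≤-trans d<H (m≤m+n H H))

    chord-aligned : ∀ {u d u' d' x y} → d < H → d' < H → lab u ≡ x → lab (u + d) ≡ y →
                    lab u' ≡ x → lab (u' + d') ≡ y → d ≡ d' × u % N ≡ u' % N
    chord-aligned d<H d'<H ux uy u'x u'y =
      trans (sym (diff-unique (<H⇒<N d<H) ux uy)) (diff-unique (<H⇒<N d'<H) u'x u'y) ,
      lab-injective (trans ux (sym u'x))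

    -- Two short chords cannot run between x and y in opposite directions:
    -- their lengths would add up to a full turn.
    chord-opposed : ∀ {u d u' d' x y} → 0 < d → d < H → d' < H → lab u ≡ x → lab (u + d) ≡ y →
                    lab u' ≡ y → lab (u' + d') ≡ x → ⊥
    chord-opposed {u} {d} {u'} {d'} {x} {y} d>0 d<H d'<H ux uy u'y u'x =
      <-irrefl (trans full-turn N≡H+H) (+-mono-< d<H d'<H)
      where
        open ≡-Reasoning
        diff≡d : diff x y ≡ d
        diff≡d = diff-unique (<H⇒<N d<H) ux uy
        x≢y : x ≢ y
        x≢y refl = <⇒≢ d>0 (trans (sym diff≡0) diff≡d)
          where
            diff≡0 : diff x x ≡ 0
            diff≡0 = diff-unique (>-nonZero⁻¹ N) ux (trans (cong lab (+-identityʳ u)) ux)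
        full-turn : d + d' ≡ N
        full-turn = begin
          d + d'              ≡⟨ cong (d +_) (diff-unique (<H⇒<N d'<H) u'y u'x) ⟨
          d + diff y x        ≡⟨ cong (d +_) (diff-flip x≢y) ⟩
          d + (N ∸ diff x y)  ≡⟨ cong (λ r → d + (N ∸ r)) diff≡d ⟩
          d + (N ∸ d)         ≡⟨ m+[n∸m]≡n (<⇒≤ (<H⇒<N d<H)) ⟩
          N                   ∎

    chord-unique : ∀ {u d u' d' x y} → 0 < d → d < H → 0 < d' → d' < H →
                   Chord u d x y → Chord u' d' x y → d ≡ d' × u % N ≡ u' % N
    chord-unique _ d<H _ d'<H (inj₁ (ux , uy)) (inj₁ (u'x , u'y)) = chord-aligned d<H d'<H ux uy u'x u'y
    chord-unique _ d<H _ d'<H (inj₂ (uy , ux)) (inj₂ (u'y , u'x)) = chord-aligned d<H d'<H uy ux u'y u'x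
    chord-unique d>0 d<H _ d'<H (inj₁ (ux , uy)) (inj₂ (u'y , u'x)) =
      ⊥-elim (chord-opposed d>0 d<H d'<H ux uy u'y u'x)
    chord-unique _ d<H d'>0 d'<H (inj₂ (uy , ux)) (inj₁ (u'x , u'y)) =
      ⊥-elim (chord-opposed d'>0 d'<H d<H u'x u'y uy ux)

    short-side : ∀ {x y} → Adj x y → H % a ≡ 0 → diff x y < H ⊎ diff y x < H
    short-side {x} {y} adj a∣H with diff x y <? H
    ... | yes short = inj₁ short
    ... | no ¬short = inj₂ (begin-strict
      diff y x      ≡⟨ diff-flip (λ x≡y → adj (cong proj₁ x≡y)) ⟩
      N ∸ diff x y  <⟨ ∸-monoʳ-< H<d (<⇒≤ (diff<N x y)) ⟩
      N ∸ H         ≡⟨ cong (_∸ H) N≡H+H ⟩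
      H + H ∸ H     ≡⟨ m+n∸n≡m H H ⟩
      H             ∎)
      where
        open ≤-Reasoning
        H<d : H < diff x y
        H<d = ≤∧≢⇒< (≮⇒≥ ¬short) (λ H≡d → adjacent-diff adj (trans (cong (_% a) (sym H≡d)) a∣H))

  -- n base paths Z s of length e whose edge lengths δ s i run exactly once
  -- through the differences d < H with a ∤ d (one from each pair ±d).
  record BaseFamily (H n e : ℕ) : Set where
    field
      Z            : Fin n → Fin (suc e) → ℕ
      δ            : Fin n → Fin e → ℕ
      Z<N          : ∀ s i → Z s i < N
      Z-injective  : ∀ s {i j} → Z s i ≡ Z s j → i ≡ j
      Z-jump       : ∀ s i → Jump (Z s (inject₁ i)) (δ s i) (Z s (fsuc i))
      δ<H          : ∀ s i → δ s i < H
      δ-admissible : ∀ s i → δ s i % a ≢ 0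
      δ-injective  : ∀ {s i s' i'} → δ s i ≡ δ s' i' → s ≡ s' × i ≡ i'
      δ-surjective : ∀ {d} → d < H → d % a ≢ 0 → Σ (Fin n) λ s → Σ (Fin e) λ i → δ s i ≡ d

  module DifferenceMethod {H n e} (N≡H+H : N ≡ H + H) (H%a≡0 : H % a ≡ 0) (F : BaseFamily H n e) where
    open BaseFamily F
    open HalfTurn {H} N≡H+H

    δ>0 : ∀ s i → 0 < δ s i
    δ>0 s i = n≢0⇒n>0 (λ δ≡0 → δ-admissible s i (trans (cong (_% a) δ≡0) (m<n⇒m%n≡m (>-nonZero⁻¹ a))))

    block : Fin n → Fin N → Seq e a b
    block s c i = lab (toℕ c + Z s i)

    low : Fin n → Fin e → ℕ
    low s i = lower (Z-jump s i)

    block-ends : ∀ s c i → Joins (block s c (inject₁ i)) (block s c (fsuc i))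
                                 (lab (toℕ c + low s i)) (lab (toℕ c + low s i + δ s i))
    block-ends s c i =
      subst (λ w → Joins (block s c (inject₁ i)) (block s c (fsuc i)) (lab (toℕ c + low s i)) (lab w))
            (sym (+-assoc (toℕ c) (low s i) (δ s i)))
            (joins-map (λ z → lab (toℕ c + z)) (jump-joins (Z-jump s i)))

    edge⇔chord : ∀ s c i x y → EdgeAt (block s c) i x y ⇔' Chord (toℕ c + low s i) (δ s i) x y
    edge⇔chord s c i x y = joins-transfer (block-ends s c i) , joins-transfer (joins-sym (block-ends s c i))

    block-path : ∀ s c → IsPathIn (block s c)
    block-path s c = injective , adjacent
      where
        injective : ∀ {i j} → block s c i ≡ block s c j → i ≡ j
        injective {i} {j} eq = Z-injective s (Modᴺ.%-injective (Z<N s i) (Z<N s j)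
                                 (Modᴺ.%-cancelˡ (toℕ c) (Z s i) (Z s j) (lab-injective eq)))
        adjacent : ∀ i → Adj (block s c (inject₁ i)) (block s c (fsuc i))
        adjacent i = joins-adjacent (block-ends s c i) (adjacent-lab _ (δ s i) (δ-admissible s i))

    block-unique : ∀ {x y} s c i s' c' i' → EdgeAt (block s c) i x y → EdgeAt (block s' c') i' x y →
                   s ≡ s' × c ≡ c' × i ≡ i'
    block-unique {x} {y} s c i s' c' i' e e'
      with chord-unique (δ>0 s i) (δ<H s i) (δ>0 s' i') (δ<H s' i')
                        (proj₁ (edge⇔chord s c i x y) e) (proj₁ (edge⇔chord s' c' i' x y) e')
    ... | δ≡δ' , start≡start' with δ-injective δ≡δ'
    ... | refl , refl = refl , toℕ-injective (Modᴺ.%-injective (toℕ<n c) (toℕ<n c')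
                                 (Modᴺ.%-cancelʳ (low s i) (toℕ c) (toℕ c') start≡start')) , refl

    block-cover : ∀ x y → diff x y < H → diff x y % a ≢ 0 →
                  Σ (Fin n) λ s → Σ (Fin N) λ c → Σ (Fin e) λ i → EdgeAt (block s c) i x y
    block-cover x y short a∤d with δ-surjective short a∤d
    ... | s , i , δ≡d = s , c , i , proj₂ (edge⇔chord s c i x y) (inj₁ (at-x , at-y))
      where
        l = low s i
        c : Fin N
        c = fromℕ< (diff<N (lab l) x)
        at-x : lab (toℕ c + l) ≡ x
        at-x = trans (cong lab (trans (cong (_+ l) (toℕ-fromℕ< _)) (+-comm _ l))) (lab-step x refl)
        at-y : lab (toℕ c + l + δ s i) ≡ y
        at-y = trans (cong (λ d → lab (toℕ c + l + d)) δ≡d) (lab-step y at-x)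

    rotate-block : ∀ s c c' → suc (toℕ c) % N ≡ toℕ c' → ∀ i → shift 1 (block s c i) ≡ block s c' i
    rotate-block s c c' next i = begin
      shift 1 (lab (toℕ c + Z s i))  ≡⟨ shift-lab 1 (toℕ c + Z s i) ⟩
      lab (toℕ c + Z s i + 1)        ≡⟨ cong lab (+-comm (toℕ c + Z s i) 1) ⟩
      lab (suc (toℕ c) + Z s i)      ≡⟨ lab-cong (Modᴺ.%-absorbˡ (suc (toℕ c)) (Z s i)) ⟨
      lab (suc (toℕ c) % N + Z s i)  ≡⟨ cong (λ r → lab (r + Z s i)) next ⟩
      lab (toℕ c' + Z s i)           ∎
      where open ≡-Reasoning

    successor predecessor : Fin N → Fin N
    successor c   = fromℕ< (m%n<n (suc (toℕ c)) N)
    predecessor c = fromℕ< (m%n<n (toℕ c + pred N) N)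

    successor-spec : ∀ c → suc (toℕ c) % N ≡ toℕ (successor c)
    successor-spec c = sym (toℕ-fromℕ< _)

    predecessor-spec : ∀ c → suc (toℕ (predecessor c)) % N ≡ toℕ c
    predecessor-spec c = begin
      (1 + toℕ (predecessor c)) % N    ≡⟨ cong (λ r → (1 + r) % N) (toℕ-fromℕ< _) ⟩
      (1 + (toℕ c + pred N) % N) % N   ≡⟨ Modᴺ.%-absorbʳ 1 (toℕ c + pred N) ⟩
      suc (toℕ c + pred N) % N         ≡⟨ cong (_% N) (+-suc (toℕ c) (pred N)) ⟨
      (toℕ c + suc (pred N)) % N       ≡⟨ cong (λ r → (toℕ c + r) % N) (suc-pred N) ⟩
      (toℕ c + N) % N                  ≡⟨ [m+n]%n≡m%n (toℕ c) N ⟩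
      toℕ c % N                        ≡⟨ m<n⇒m%n≡m (toℕ<n c) ⟩
      toℕ c                            ∎
      where open ≡-Reasoning

    blocks : Fin (n * N) → Seq e a b
    blocks k = uncurry block (remQuot {n} N k)

    blocks-combine : ∀ s c i → blocks (combine s c) i ≡ block s c i
    blocks-combine s c i = cong (λ p → uncurry block p i) (remQuot-combine s c)

    EdgeIn : V → V → Set
    EdgeIn x y = Σ (Fin (n * N) × Fin e) λ (k , i) → EdgeAt (blocks k) i x y

    short-cover : ∀ x y → diff x y < H → diff x y % a ≢ 0 → EdgeIn x y
    short-cover x y short a∤d = (combine s c , i) , subst (λ p → EdgeAt p i x y) (sym block≡) edge
      where
        found = block-cover x y short a∤d
        s = proj₁ found
        c = proj₁ (proj₂ found)
        i = proj₁ (proj₂ (proj₂ found))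
        edge = proj₂ (proj₂ (proj₂ found))
        block≡ : blocks (combine s c) ≡ block s c
        block≡ = cong (uncurry block) (remQuot-combine s c)

    -- Every edge of K_{a×b} is short in one direction, hence covered.
    cover : ∀ x y → Adj x y → EdgeIn x y
    cover x y adj with short-side adj H%a≡0
    ... | inj₁ short = short-cover x y short (adjacent-diff adj)
    ... | inj₂ short = map₂ joins-flip (short-cover y x short (adjacent-diff (λ eq → adj (sym eq))))

    unique : ∀ x y k i k' i' → EdgeAt (blocks k) i x y → EdgeAt (blocks k') i' x y → k ≡ k' × i ≡ i'
    unique x y k i k' i' edge edge' = (begin
      k                                   ≡⟨ combine-remQuot {n} N k ⟨
      uncurry combine (remQuot {n} N k)   ≡⟨ cong₂ combine s≡s' c≡c' ⟩
      uncurry combine (remQuot {n} N k')  ≡⟨ combine-remQuot {n} N k' ⟩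
      k'                                  ∎) , i≡i'
      where
        open ≡-Reasoning
        same = block-unique (proj₁ (remQuot {n} N k)) (proj₂ (remQuot {n} N k)) i
                            (proj₁ (remQuot {n} N k')) (proj₂ (remQuot {n} N k')) i' edge edge'
        s≡s' = proj₁ same
        c≡c' = proj₁ (proj₂ same)
        i≡i' = proj₂ (proj₂ same)

    decomposition : IsPathDecomposition blocks
    decomposition = (λ k → uncurry block-path (remQuot {n} N k)) , λ x y adj → cover x y adj , unique x y

    rotation-maps-blocks : MapsBlocksOnto rotation blocks
    rotation-maps-blocks = forward , backward
      where
        forward : ∀ k → Σ (Fin (n * N)) λ k' → SameSubgraph (λ i → shift 1 (blocks k i)) (blocks k')
        forward k = combine s (successor c) , same-subgraph λ i →
            trans (rotate-block s c (successor c) (successor-spec c) i) (sym (blocks-combine s (successor c) i))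
          where
            s = proj₁ (remQuot {n} N k)
            c = proj₂ (remQuot {n} N k)
        backward : ∀ k' → Σ (Fin (n * N)) λ k → SameSubgraph (λ i → shift 1 (blocks k i)) (blocks k')
        backward k' = combine s (predecessor c) , same-subgraph λ i →
            trans (cong (shift 1) (blocks-combine s (predecessor c) i))
                  (rotate-block s (predecessor c) c (predecessor-spec c) i)
          where
            s = proj₁ (remQuot {n} N k')
            c = proj₂ (remQuot {n} N k')

    cyclic-decomposition : HasCyclicPathDecomposition e a b
    cyclic-decomposition = n * N , blocks , decomposition , rotation , rotation-cycle , rotation-maps-blocks

module ZigzagFamily (m K n e : ℕ) .{{_ : NonZero m}} (Km≡ne : K * m ≡ n * e) (e>0 : 0 < e) where
  open Differences m K

  row : Fin n → ℕ → ℕ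
  row s i = Δ (e * toℕ s + i)

  row-index< : ∀ s {i} → i < e → e * toℕ s + i < K * m
  row-index< s {i} i<e = begin-strict
    e * toℕ s + i     <⟨ +-monoʳ-< (e * toℕ s) i<e ⟩
    e * toℕ s + e     ≡⟨ trans (+-comm (e * toℕ s) e) (sym (*-suc e (toℕ s))) ⟩
    e * suc (toℕ s)   ≤⟨ *-monoʳ-≤ e (toℕ<n s) ⟩
    e * n             ≡⟨ *-comm e n ⟩
    n * e             ≡⟨ Km≡ne ⟨
    K * m             ∎
    where open ≤-Reasoning

  row-descending : ∀ s → Descending (row s) e
  row-descending s i i<e =
    subst (λ G → Δ G < row s i) (sym (+-suc (e * toℕ s) i)) (Δ-descending (row-index< s i<e))

  family : ∀ b .{{_ : NonZero b}} → H ≤ Circulant.N a b → Circulant.BaseFamily a b H n e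
  family b H≤N = record
    { Z            = λ s i → zigzag (row s) (toℕ i)
    ; δ            = λ s i → row s (toℕ i)
    ; Z<N          = λ s i → ≤-<-trans (zigzag≤ (row s) (toℕ i)) (<-≤-trans (Δ<H (row-index< s e>0)) H≤N)
    ; Z-injective  = λ s {i} {j} eq → toℕ-injective
                       (zigzag-injective (row-descending s) (≤-pred (toℕ<n i)) (≤-pred (toℕ<n j)) eq)
    ; Z-jump       = λ s i → subst (λ j → Jump (zigzag (row s) j) (row s (toℕ i)) (zigzag (row s) (suc (toℕ i))))
                               (sym (toℕ-inject₁ i)) (zigzag-jump (row-descending s) (toℕ<n i))
    ; δ<H          = λ s i → Δ<H (row-index< s (toℕ<n i))
    ; δ-admissible = λ s i → Δ-admissible (row-index< s (toℕ<n i))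
    ; δ-injective  = injective
    ; δ-surjective = surjective
    }
    where
      injective : ∀ {s i s' i'} → row s (toℕ i) ≡ row s' (toℕ i') → s ≡ s' × i ≡ i'
      injective {s} {i} {s'} {i'} eq = combine-injectiveˡ s i s' i' same , combine-injectiveʳ s i s' i' same
        where
          same : combine s i ≡ combine s' i'
          same = toℕ-injective (trans (toℕ-combine s i) (trans
                   (Δ-injective (row-index< s (toℕ<n i)) (row-index< s' (toℕ<n i')) eq)
                   (sym (toℕ-combine s' i'))))

      surjective : ∀ {d} → d < H → d % a ≢ 0 → Σ (Fin n) λ s → Σ (Fin e) λ i → row s (toℕ i) ≡ d
      surjective {d} d<H a∤d with Δ-surjective d<H a∤d
      ... | G , G<Km , ΔG≡d = proj₁ (remQuot {n} e g) , proj₂ (remQuot {n} e g) , (begin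
          Δ (e * toℕ s + toℕ i)      ≡⟨ cong Δ (toℕ-combine s i) ⟨
          Δ (toℕ (combine s i))      ≡⟨ cong (λ k → Δ (toℕ k)) (combine-remQuot {n} e g) ⟩
          Δ (toℕ g)                  ≡⟨ cong Δ (toℕ-fromℕ< _) ⟩
          Δ G                        ≡⟨ ΔG≡d ⟩
          d                          ∎)
        where
          open ≡-Reasoning
          g : Fin (n * e)
          g = fromℕ< (subst (G <_) Km≡ne G<Km)
          s = proj₁ (remQuot {n} e g)
          i = proj₂ (remQuot {n} e g)

proposition3p2 : (e n d : ℕ) → .{{_ : NonZero d}} → e ≥ 1 → n ≥ 1 → d ∣ e →
    HasCyclicPathDecomposition e (e / d + 1) (2 * d * n)
proposition3p2 e n d e≥1 n≥1 d∣e =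
  Circulant.DifferenceMethod.cyclic-decomposition a b N≡H+H H%a≡0 (family b H≤N)
  where
    m = e / d
    K = d * n
    b = 2 * d * n

    d*m≡e : d * m ≡ e
    d*m≡e = m*[n/m]≡n d∣e

    instance
      m≢0 : NonZero m
      m≢0 = ≢-nonZero (λ m≡0 → <⇒≢ e≥1 (sym (trans (sym d*m≡e) (trans (cong (d *_) m≡0) (*-zeroʳ d)))))
      b≢0 : NonZero b
      b≢0 = m*n≢0 (2 * d) n {{m*n≢0 2 d}} {{>-nonZero n≥1}}

    open Differences m K using (a; H; a≢0; H%a≡0)

    Km≡ne : K * m ≡ n * e
    Km≡ne = trans (regroup d n m) (cong (n *_) d*m≡e)
      where
        regroup : ∀ d n m → d * n * m ≡ n * (d * m)
        regroup = solve-∀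

    N≡H+H : Circulant.N a b ≡ H + H
    N≡H+H = double d n a
      where
        double : ∀ d n a → 2 * d * n * a ≡ d * n * a + d * n * a
        double = solve-∀

    H≤N : H ≤ Circulant.N a b
    H≤N = subst (H ≤_) (sym N≡H+H) (m≤m+n H H)

    open ZigzagFamily m K n e Km≡ne e≥1 using (family)
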